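{- Let $c,\alpha\in[0,1]$, and let $e,d$ be reals with $1\geq e\geq c$, $\alpha c\geq d\geq 0$ and $d<c$, such that $$\frac{\alpha c-d}{c-d}<\frac{c-d}{e-d}.$$ Let $n$ be a positive integer such that $cn$, $dn$, $en$ are integers. Then $$P(n,c,\alpha)\leq\binom{n}{cn}\,N\!\left(\frac{c-d}{e-d},\frac{\alpha c-d}{c-d}\right)\Bigm/\binom{(e-d)n}{(e-c)n},$$ where $N(x,y)=\frac{1-y}{x-y}$.
   Context: For a positive integer $N'$ and reals $c',\alpha'\in[0,1]$ with $c'N'$ an integer, $P(N',c',\alpha')$ denotes the maximum number of $c'N'$-element subsets of an $N'$-element set such that any two distinct ones intersect in fewer than $\alpha'c'N'$ elements.
   Formalization: The parameter α ranges over the rationals in [0,1] rather than the reals. -}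

module Defs where

open import Data.Nat as ℕ using (ℕ)
open import Data.Integer using (+_)
open import Data.Fin using (Fin)
open import Data.Fin.Subset using (Subset; _∩_; ∣_∣)
open import Data.Rational using (ℚ; 0ℚ; 1ℚ; _-_; _*_; _÷_; _<_; ≢-nonZero)
open import Data.Rational.Properties using (_≟_)
open import Data.Nat.Combinatorics using (_C_)
open import Relation.Nullary using (yes; no; ¬_)
open import Relation.Binary.PropositionalEquality using (_≡_)
open import Data.Product using (_×_)

ℕ→ℚ : ℕ → ℚ
ℕ→ℚ k = (+ k) Data.Rational./ 1

-- total division on ℚ (x / 0 := 0); only used with nonzero denominators
_/'_ : ℚ → ℚ → ℚ
p /' q with q ≟ 0ℚ
... | yes _ = 0ℚ
... | no q≢0 = _÷_ p q {{≢-nonZero q≢0}}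

Nfun : ℚ → ℚ → ℚ
Nfun x y = (1ℚ - y) /' (x - y)

-- A family F : Fin m → Subset n is admissible for P(n,c,α) (with K = cn)
-- if all members have exactly K elements, members are pairwise distinct,
-- and any two distinct members intersect in fewer than α·K elements.
Admissible : (n K : ℕ) (α : ℚ) (m : ℕ) → (Fin m → Subset n) → Set
Admissible n K α m F =
  ((i : Fin m) → ∣ F i ∣ ≡ K) ×
  ((i j : Fin m) → ¬ (i ≡ j) → ¬ (F i ≡ F j) × (ℕ→ℚ ∣ F i ∩ F j ∣ < α * ℕ→ℚ K))

-- Averaging over a vertex v compares a family with its link (the members containing v, with v deleted) and its
-- deletion (the members avoiding v). A K-set on N + 1 points lies in K links and in N + 1 − K deletions, so a
-- bound on the density |F| / C(N, K) of K-uniform families on N points passes up to (N + 1, K + 1), with the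
-- intersection sizes shifted by one, and to (N + 1, K). Going up dn times through links and (1 − e)n times through
-- deletions, it suffices to bound families of k′ = (c − d)n-sets on n′ = (e − d)n points with pairwise
-- intersections below θ = (αc − d)n. For those the second-moment (Johnson) argument applies: with vertex degrees
-- deg, (Σ deg)² ≤ n′ Σ deg² and Σ deg² = Σ_{A,B} |A ∩ B| ≤ |F| k′ + |F| (|F| − 1) θ, whence
-- |F| (k′² − n′θ) ≤ n′ (k′ − θ). Since k′/n′ = (c − d)/(e − d) and θ/k′ = (αc − d)/(c − d), the ratio
-- n′ (k′ − θ) / (k′² − n′θ) is exactly N(x, y).

module Submission where

open import Defs

module Counting where
  open import Data.Bool using (Bool; true; false; _∧_)
  open import Data.Bool.Properties using (_≟_; ∧-idem)
  open import Data.Fin using (Fin; zero; suc)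
  open import Data.Fin.Subset using (Subset; Side; outside; _∩_; ∣_∣)
  open import Data.List using (List; []; _∷_; length)
  open import Data.List.Relation.Unary.All using (All; []; _∷_)
  open import Data.List.Relation.Unary.AllPairs using (AllPairs; []; _∷_)
  open import Data.Nat hiding (_≟_)
  open import Data.Nat.Properties hiding (_≟_)
  open import Data.Nat.Combinatorics using (_C_; nCk+nC[k+1]≡[n+1]C[k+1]; nC1≡n; nCk≡nC[n∸k])
  open import Data.Nat.Combinatorics.Specification using (k>n⇒nCk≡0)
  open import Data.Nat.Tactic.RingSolver using (solve-∀)
  open import Data.Product using (_×_; _,_)
  open import Data.Sum using ([_,_]′)
  open import Data.Vec using ([]; _∷_; lookup; removeAt; count)
  open import Data.Vec.Properties using (lookup-zipWith)
  open import Algebra.Properties.Semiring.Sum +-*-semiring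
    using (sum-syntax; sum-cong-≗; sum-replicate-zero; ∑-distrib-+; *-distribˡ-sum)
  open import Function using (_∘_)
  open import Relation.Nullary using (does; yes; no)
  open import Relation.Binary.PropositionalEquality

  𝟙 : Bool → ℕ
  𝟙 true  = 1
  𝟙 false = 0

  χ : ∀ {n} → Subset n → Fin n → ℕ
  χ A v = 𝟙 (lookup A v)

  𝟙-∧ : ∀ a b → 𝟙 (a ∧ b) ≡ 𝟙 a * 𝟙 b
  𝟙-∧ true  b = sym (+-identityʳ (𝟙 b))
  𝟙-∧ false b = refl

  𝟙-idem : ∀ a → 𝟙 a * 𝟙 a ≡ 𝟙 a
  𝟙-idem a = trans (sym (𝟙-∧ a a)) (cong 𝟙 (∧-idem a))

  ∣∷∣ : ∀ {n} x (A : Subset n) → ∣ x ∷ A ∣ ≡ 𝟙 x + ∣ A ∣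
  ∣∷∣ true  A = refl
  ∣∷∣ false A = refl

  ∣∣≡∑χ : ∀ {n} (A : Subset n) → ∣ A ∣ ≡ ∑[ v < n ] χ A v
  ∣∣≡∑χ []      = refl
  ∣∣≡∑χ (x ∷ A) = trans (∣∷∣ x A) (cong (𝟙 x +_) (∣∣≡∑χ A))

  χ-∩ : ∀ {n} (A B : Subset n) v → χ (A ∩ B) v ≡ χ A v * χ B v
  χ-∩ A B v = trans (cong 𝟙 (lookup-zipWith _∧_ v A B)) (𝟙-∧ (lookup A v) (lookup B v))

  ∣∩∣≡∑χχ : ∀ {n} (A B : Subset n) → ∣ A ∩ B ∣ ≡ ∑[ v < n ] (χ A v * χ B v)
  ∣∩∣≡∑χχ A B = trans (∣∣≡∑χ (A ∩ B)) (sum-cong-≗ (χ-∩ A B))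

  deg : ∀ {n} → List (Subset n) → Fin n → ℕ
  deg []      v = 0
  deg (A ∷ L) v = χ A v + deg L v

  ∑-deg : ∀ {n k} (L : List (Subset n)) → All (λ A → ∣ A ∣ ≡ k) L →
          ∑[ v < n ] deg L v ≡ length L * k
  ∑-deg {n} []      []             = sum-replicate-zero n
  ∑-deg {n} (A ∷ L) (refl ∷ sizes) = begin
    ∑[ v < n ] (χ A v + deg L v)          ≡⟨ ∑-distrib-+ (χ A) (deg L) ⟩
    ∑[ v < n ] χ A v + ∑[ v < n ] deg L v  ≡⟨ cong₂ _+_ (sym (∣∣≡∑χ A)) (∑-deg L sizes) ⟩
    ∣ A ∣ + length L * ∣ A ∣               ∎
    where open ≡-Reasoning

  intersections : ∀ {n} → Subset n → List (Subset n) → ℕ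
  intersections A []      = 0
  intersections A (B ∷ L) = ∣ A ∩ B ∣ + intersections A L

  ∑χ*deg≡intersections : ∀ {n} (A : Subset n) L → ∑[ v < n ] (χ A v * deg L v) ≡ intersections A L
  ∑χ*deg≡intersections {n} A []      = trans (sum-cong-≗ (*-zeroʳ ∘ χ A)) (sum-replicate-zero n)
  ∑χ*deg≡intersections {n} A (B ∷ L) = begin
    ∑[ v < n ] (χ A v * (χ B v + deg L v))
      ≡⟨ sum-cong-≗ (λ v → *-distribˡ-+ (χ A v) (χ B v) (deg L v)) ⟩
    ∑[ v < n ] (χ A v * χ B v + χ A v * deg L v)
      ≡⟨ ∑-distrib-+ (λ v → χ A v * χ B v) (λ v → χ A v * deg L v) ⟩
    ∑[ v < n ] (χ A v * χ B v) + ∑[ v < n ] (χ A v * deg L v)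
      ≡⟨ cong₂ _+_ (sym (∣∩∣≡∑χχ A B)) (∑χ*deg≡intersections A L) ⟩
    ∣ A ∩ B ∣ + intersections A L
      ∎
    where open ≡-Reasoning

  moment₂ : ∀ {n} → List (Subset n) → ℕ
  moment₂ {n} L = ∑[ v < n ] (deg L v * deg L v)

  moment₂-∷ : ∀ {n} (A : Subset n) L → moment₂ (A ∷ L) ≡ ∣ A ∣ + 2 * intersections A L + moment₂ L
  moment₂-∷ {n} A L = begin
    ∑[ v < n ] ((χ A v + deg L v) * (χ A v + deg L v))
      ≡⟨ sum-cong-≗ (λ v → square-expand (χ A v) (deg L v) (𝟙-idem (lookup A v))) ⟩
    ∑[ v < n ] (χ A v + 2 * (χ A v * deg L v) + deg L v * deg L v)
      ≡⟨ ∑-distrib-+ (λ v → χ A v + 2 * (χ A v * deg L v)) (λ v → deg L v * deg L v) ⟩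
    ∑[ v < n ] (χ A v + 2 * (χ A v * deg L v)) + moment₂ L
      ≡⟨ cong (_+ moment₂ L) (∑-distrib-+ (χ A) (λ v → 2 * (χ A v * deg L v))) ⟩
    ∑[ v < n ] χ A v + ∑[ v < n ] (2 * (χ A v * deg L v)) + moment₂ L
      ≡⟨ cong₂ (λ a b → a + b + moment₂ L) (sym (∣∣≡∑χ A))
               (trans (sym (*-distribˡ-sum 2 (λ v → χ A v * deg L v))) (cong (2 *_) (∑χ*deg≡intersections A L))) ⟩
    ∣ A ∣ + 2 * intersections A L + moment₂ L
      ∎
    where
    open ≡-Reasoning
    square-expand : ∀ x y → x * x ≡ x → (x + y) * (x + y) ≡ x + 2 * (x * y) + y * y
    square-expand x y x²≡x = trans (expand x y) (cong (λ z → z + 2 * (x * y) + y * y) x²≡x)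
      where
      expand : ∀ x y → (x + y) * (x + y) ≡ x * x + 2 * (x * y) + y * y
      expand = solve-∀

  am-gm : ∀ a b → 2 * (a * b) ≤ a * a + b * b
  am-gm a b = [ ordered , swapped ]′ (≤-total a b)
    where
    ordered : ∀ {a b} → a ≤ b → 2 * (a * b) ≤ a * a + b * b
    ordered {a} a≤b with t , refl ← m≤n⇒∃[o]m+o≡n a≤b =
      ≤-trans (m≤m+n _ (t * t)) (≤-reflexive (square-gap a t))
      where
      square-gap : ∀ a t → 2 * (a * (a + t)) + t * t ≡ a * a + (a + t) * (a + t)
      square-gap = solve-∀
    swapped : b ≤ a → 2 * (a * b) ≤ a * a + b * b
    swapped b≤a = subst₂ _≤_ (cong (2 *_) (*-comm b a)) (+-comm (b * b) (a * a)) (ordered b≤a)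

  cross-term-bound : ∀ n x S Q → S * S ≤ n * Q → 2 * (x * S) ≤ n * (x * x) + Q
  cross-term-bound zero    x zero    Q _  = ≤-trans (≤-reflexive (cong (2 *_) (*-zeroʳ x))) z≤n
  cross-term-bound zero    x (suc S) Q ()
  cross-term-bound (suc n) x S       Q S²≤nQ = *-cancelˡ-≤ (suc n) (begin
    suc n * (2 * (x * S))               ≡⟨ regroup (suc n) x S ⟩
    2 * ((suc n * x) * S)               ≤⟨ am-gm (suc n * x) S ⟩
    suc n * x * (suc n * x) + S * S     ≤⟨ +-monoʳ-≤ _ S²≤nQ ⟩
    suc n * x * (suc n * x) + suc n * Q ≡⟨ factor (suc n) x Q ⟩
    suc n * (suc n * (x * x) + Q)       ∎)
    where
    open ≤-Reasoning
    regroup : ∀ m x S → m * (2 * (x * S)) ≡ 2 * ((m * x) * S)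
    regroup = solve-∀
    factor : ∀ m x Q → m * x * (m * x) + m * Q ≡ m * (m * (x * x) + Q)
    factor = solve-∀

  cauchy-schwarz : ∀ n (u : Fin n → ℕ) →
                   (∑[ v < n ] u v) * (∑[ v < n ] u v) ≤ n * ∑[ v < n ] (u v * u v)
  cauchy-schwarz zero    u = z≤n
  cauchy-schwarz (suc n) u = begin
    (x + S) * (x + S)                     ≡⟨ expand x S ⟩
    x * x + 2 * (x * S) + S * S           ≤⟨ +-mono-≤ (+-monoʳ-≤ (x * x) (cross-term-bound n x S Q ih)) ih ⟩
    x * x + (n * (x * x) + Q) + n * Q     ≡⟨ collect n x Q ⟩
    suc n * (x * x + Q)                   ∎
    where
    open ≤-Reasoning
    expand : ∀ x S → (x + S) * (x + S) ≡ x * x + 2 * (x * S) + S * S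
    expand = solve-∀
    collect : ∀ n x Q → x * x + (n * (x * x) + Q) + n * Q ≡ suc n * (x * x + Q)
    collect = solve-∀
    x S Q : ℕ
    x = u zero
    S = ∑[ v < n ] u (suc v)
    Q = ∑[ v < n ] (u (suc v) * u (suc v))
    ih : S * S ≤ n * Q
    ih = cauchy-schwarz n (u ∘ suc)

  square-≤-moment₂ : ∀ {n k} (L : List (Subset n)) → All (λ A → ∣ A ∣ ≡ k) L →
                     (length L * k) * (length L * k) ≤ n * moment₂ L
  square-≤-moment₂ {n} L sizes = subst (λ s → s * s ≤ n * moment₂ L) (∑-deg L sizes) (cauchy-schwarz n (deg L))

  ∣∣-removeAt : ∀ {n} (A : Subset (suc n)) v → ∣ A ∣ ≡ χ A v + ∣ removeAt A v ∣
  ∣∣-removeAt (x ∷ A)     zero    = ∣∷∣ x A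
  ∣∣-removeAt (x ∷ y ∷ A) (suc v) = begin
    ∣ x ∷ y ∷ A ∣                                 ≡⟨ ∣∷∣ x (y ∷ A) ⟩
    𝟙 x + ∣ y ∷ A ∣                               ≡⟨ cong (𝟙 x +_) (∣∣-removeAt (y ∷ A) v) ⟩
    𝟙 x + (χ (y ∷ A) v + ∣ removeAt (y ∷ A) v ∣)  ≡⟨ +-exchange (𝟙 x) (χ (y ∷ A) v) ∣ removeAt (y ∷ A) v ∣ ⟩
    χ (y ∷ A) v + (𝟙 x + ∣ removeAt (y ∷ A) v ∣)  ≡⟨ cong (χ (y ∷ A) v +_) (∣∷∣ x (removeAt (y ∷ A) v)) ⟨
    χ (y ∷ A) v + ∣ x ∷ removeAt (y ∷ A) v ∣      ∎
    where
    open ≡-Reasoning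
    +-exchange : ∀ a b c → a + (b + c) ≡ b + (a + c)
    +-exchange = solve-∀

  removeAt-∩ : ∀ {n} (A B : Subset (suc n)) v → removeAt (A ∩ B) v ≡ removeAt A v ∩ removeAt B v
  removeAt-∩ (x ∷ A)      (y ∷ B)      zero    = refl
  removeAt-∩ (x ∷ x′ ∷ A) (y ∷ y′ ∷ B) (suc v) = cong ((x ∧ y) ∷_) (removeAt-∩ (x′ ∷ A) (y′ ∷ B) v)

  sideCount : ∀ {n} → Side → Subset n → ℕ
  sideCount s = count (_≟ s)

  ∑-𝟙≡sideCount : ∀ {n} s (A : Subset n) → ∑[ v < n ] (𝟙 (does (lookup A v ≟ s))) ≡ sideCount s A
  ∑-𝟙≡sideCount s []      = refl
  ∑-𝟙≡sideCount s (x ∷ A) with does (x ≟ s)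
  ... | true  = cong suc (∑-𝟙≡sideCount s A)
  ... | false = ∑-𝟙≡sideCount s A

  sideCount-outside+∣∣ : ∀ {n} (A : Subset n) → sideCount outside A + ∣ A ∣ ≡ n
  sideCount-outside+∣∣ []          = refl
  sideCount-outside+∣∣ (true  ∷ A) = trans (+-suc _ _) (cong suc (sideCount-outside+∣∣ A))
  sideCount-outside+∣∣ (false ∷ A) = cong suc (sideCount-outside+∣∣ A)

  UniformFamily : ∀ {n} → ℕ → (ℕ → Set) → List (Subset n) → Set
  UniformFamily k P L = All (λ A → ∣ A ∣ ≡ k) L × AllPairs (λ A B → P ∣ A ∩ B ∣) L

  -- The link (s = inside) or the deletion (s = outside) of v: the members on side s at v, with v removed.
  slice : ∀ {n} → Side → Fin (suc n) → List (Subset (suc n)) → List (Subset n)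
  slice s v []      = []
  slice s v (A ∷ L) with lookup A v ≟ s
  ... | yes _ = removeAt A v ∷ slice s v L
  ... | no  _ = slice s v L

  length-slice-∷ : ∀ {n} s v (A : Subset (suc n)) L →
                   length (slice s v (A ∷ L)) ≡ 𝟙 (does (lookup A v ≟ s)) + length (slice s v L)
  length-slice-∷ s v A L with lookup A v ≟ s
  ... | yes _ = refl
  ... | no  _ = refl

  ∑-length-slice : ∀ {n c} s (L : List (Subset (suc n))) → All (λ A → sideCount s A ≡ c) L →
                   ∑[ v < suc n ] length (slice s v L) ≡ length L * c
  ∑-length-slice {n} s []      []             = sum-replicate-zero (suc n)
  ∑-length-slice {n} s (A ∷ L) (refl ∷ counts) = begin
    ∑[ v < suc n ] length (slice s v (A ∷ L))
      ≡⟨ sum-cong-≗ (λ v → length-slice-∷ s v A L) ⟩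
    ∑[ v < suc n ] (𝟙 (does (lookup A v ≟ s)) + length (slice s v L))
      ≡⟨ ∑-distrib-+ (λ v → 𝟙 (does (lookup A v ≟ s))) (λ v → length (slice s v L)) ⟩
    ∑[ v < suc n ] (𝟙 (does (lookup A v ≟ s))) + ∑[ v < suc n ] length (slice s v L)
      ≡⟨ cong₂ _+_ (∑-𝟙≡sideCount s A) (∑-length-slice s L counts) ⟩
    sideCount s A + length L * sideCount s A
      ∎
    where open ≡-Reasoning

  All-slice⁺ : ∀ {n} {Q : Subset (suc n) → Set} {Q′ : Subset n → Set} s v →
               (∀ A → lookup A v ≡ s → Q A → Q′ (removeAt A v)) →
               ∀ {L} → All Q L → All Q′ (slice s v L)
  All-slice⁺ s v step []               = []
  All-slice⁺ s v step {A ∷ L} (qA ∷ qL) with lookup A v ≟ s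
  ... | yes Av≡s = step A Av≡s qA ∷ All-slice⁺ s v step qL
  ... | no  _    = All-slice⁺ s v step qL

  AllPairs-slice⁺ : ∀ {n} {R : Subset (suc n) → Subset (suc n) → Set} {R′ : Subset n → Subset n → Set} s v →
                    (∀ A B → lookup A v ≡ s → lookup B v ≡ s → R A B → R′ (removeAt A v) (removeAt B v)) →
                    ∀ {L} → AllPairs R L → AllPairs R′ (slice s v L)
  AllPairs-slice⁺ s v step []                    = []
  AllPairs-slice⁺ s v step {A ∷ L} (rA ∷ rL) with lookup A v ≟ s
  ... | yes Av≡s = All-slice⁺ s v (λ B → step A B Av≡s) rA ∷ AllPairs-slice⁺ s v step rL
  ... | no  _    = AllPairs-slice⁺ s v step rL

  slice-uniform : ∀ {n k P} s v {L : List (Subset (suc n))} →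
                  UniformFamily (𝟙 s + k) P L → UniformFamily k (P ∘ (𝟙 s +_)) (slice s v L)
  slice-uniform {k = k} {P = P} s v (sizes , pairs) = All-slice⁺ s v size-drops sizes , AllPairs-slice⁺ s v meet-drops pairs
    where
    size-drops : ∀ A → lookup A v ≡ s → ∣ A ∣ ≡ 𝟙 s + k → ∣ removeAt A v ∣ ≡ k
    size-drops A Av≡s ∣A∣≡ = +-cancelˡ-≡ (𝟙 s) _ _ (begin
      𝟙 s + ∣ removeAt A v ∣    ≡⟨ cong (λ b → 𝟙 b + ∣ removeAt A v ∣) Av≡s ⟨
      χ A v + ∣ removeAt A v ∣  ≡⟨ ∣∣-removeAt A v ⟨
      ∣ A ∣                     ≡⟨ ∣A∣≡ ⟩
      𝟙 s + k                   ∎)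
      where open ≡-Reasoning
    meet-drops : ∀ A B → lookup A v ≡ s → lookup B v ≡ s → P ∣ A ∩ B ∣ →
                 P (𝟙 s + ∣ removeAt A v ∩ removeAt B v ∣)
    meet-drops A B Av≡s Bv≡s = subst P (begin
      ∣ A ∩ B ∣                                        ≡⟨ ∣∣-removeAt (A ∩ B) v ⟩
      χ (A ∩ B) v + ∣ removeAt (A ∩ B) v ∣             ≡⟨ cong₂ _+_ χ≡ (cong ∣_∣ (removeAt-∩ A B v)) ⟩
      𝟙 s + ∣ removeAt A v ∩ removeAt B v ∣            ∎)
      where
      open ≡-Reasoning
      χ≡ : χ (A ∩ B) v ≡ 𝟙 s
      χ≡ = trans (cong 𝟙 (trans (lookup-zipWith _∧_ v A B) (cong₂ _∧_ Av≡s Bv≡s))) (cong 𝟙 (∧-idem s))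

  suc-*-C-suc : ∀ n k → suc k * (suc n C suc k) ≡ suc n * (n C k)
  suc-*-C-suc zero    zero    = refl
  suc-*-C-suc zero    (suc k) rewrite k>n⇒nCk≡0 {1} {suc (suc k)} (s≤s (s≤s z≤n))
                                    | k>n⇒nCk≡0 {0} {suc k} (s≤s z≤n) = *-zeroʳ (suc (suc k))
  suc-*-C-suc (suc n) zero    = trans (+-identityʳ _) (trans (nC1≡n (suc (suc n))) (sym (*-identityʳ (suc (suc n)))))
  suc-*-C-suc (suc n) (suc k) = begin
    (2 + k) * ((2 + n) C (2 + k))
      ≡⟨ cong ((2 + k) *_) (pascal (1 + n) (1 + k)) ⟨
    (2 + k) * ((1 + n) C (1 + k) + (1 + n) C (2 + k))
      ≡⟨ split k ((1 + n) C (1 + k)) ((1 + n) C (2 + k)) ⟩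
    (1 + n) C (1 + k) + ((1 + k) * ((1 + n) C (1 + k)) + (2 + k) * ((1 + n) C (2 + k)))
      ≡⟨ cong ((1 + n) C (1 + k) +_) (cong₂ _+_ (suc-*-C-suc n k) (suc-*-C-suc n (suc k))) ⟩
    (1 + n) C (1 + k) + ((1 + n) * (n C k) + (1 + n) * (n C (1 + k)))
      ≡⟨ cong ((1 + n) C (1 + k) +_) (trans (sym (*-distribˡ-+ (1 + n) (n C k) (n C (1 + k)))) (cong ((1 + n) *_) (pascal n k))) ⟩
    (1 + n) C (1 + k) + (1 + n) * ((1 + n) C (1 + k))
      ∎
    where
    open ≡-Reasoning
    pascal : ∀ n k → n C k + n C suc k ≡ suc n C suc k
    pascal = nCk+nC[k+1]≡[n+1]C[k+1]
    split : ∀ k a b → (2 + k) * (a + b) ≡ a + ((1 + k) * a + (2 + k) * b)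
    split = solve-∀

  ∸-*-C : ∀ {n k} → k ≤ n → (suc n ∸ k) * (suc n C k) ≡ suc n * (n C k)
  ∸-*-C {n} {k} k≤n = begin
    (suc n ∸ k) * (suc n C k)                ≡⟨ cong₂ _*_ 1+n∸k≡ (trans (nCk≡nC[n∸k] (m≤n⇒m≤1+n k≤n)) (cong (suc n C_) 1+n∸k≡)) ⟩
    suc (n ∸ k) * (suc n C suc (n ∸ k))      ≡⟨ suc-*-C-suc n (n ∸ k) ⟩
    suc n * (n C (n ∸ k))                    ≡⟨ cong (suc n *_) (nCk≡nC[n∸k] k≤n) ⟨
    suc n * (n C k)                          ∎
    where
    open ≡-Reasoning
    1+n∸k≡ : suc n ∸ k ≡ suc (n ∸ k)
    1+n∸k≡ = +-∸-assoc 1 k≤n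

  C-pos : ∀ {n k} → k ≤ n → 0 < n C k
  C-pos {n}     {zero}  _         = s≤s z≤n
  C-pos {suc n} {suc k} (s≤s k≤n) = ≤-trans (C-pos k≤n) (≤-trans (m≤m+n _ _) (≤-reflexive (nCk+nC[k+1]≡[n+1]C[k+1] n k)))

open Counting

open import Data.Empty using (⊥-elim)
open import Data.Fin using (Fin)
open import Data.Fin.Subset using (Subset; inside; outside; _∩_; ∣_∣)
import Data.Integer as ℤ
open import Data.Integer.Tactic.RingSolver using (solve-∀)
open import Data.List using (List; []; _∷_; length; tabulate)
open import Data.List.Properties using (length-tabulate)
open import Data.List.Relation.Unary.All as All using (All; []; _∷_)
open import Data.List.Relation.Unary.All.Properties using (tabulate⁺)
open import Data.List.Relation.Unary.AllPairs as AllPairs using (AllPairs; []; _∷_)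
import Data.List.Relation.Unary.AllPairs.Properties as AllPairs
open import Data.Nat as ℕ using (ℕ; zero; suc; z≤n; s≤s)
open import Data.Nat.Combinatorics using (_C_; nCk≡nC[n∸k])
open import Data.Nat.Coprimality using (1-coprimeTo)
import Data.Nat.Coprimality as Coprime
import Data.Nat.Properties as ℕ
open import Algebra.Properties.Semiring.Sum ℕ.+-*-semiring using (sum-syntax; sum-replicate-zero)
open import Data.Product using (_,_; proj₁; proj₂)
open import Data.Rational using (ℚ; 0ℚ; 1ℚ; _+_; _-_; _*_; -_; _≤_; _<_; toℚᵘ; positive; nonNegative; ≢-nonZero)
open import Data.Rational.Properties
open import Data.Rational.Solver using (module +-*-Solver)
open import Data.Rational.Unnormalised as ℚᵘ using (mkℚᵘ; *≡*)
import Data.Rational.Unnormalised.Properties as ℚᵘ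
open import Function using (_∘_; id)
open import Relation.Binary.PropositionalEquality
open import Relation.Nullary using (yes; no)

toℚᵘ-ℕ→ℚ : ∀ k → toℚᵘ (ℕ→ℚ k) ≡ mkℚᵘ (ℤ.+ k) 0
toℚᵘ-ℕ→ℚ k rewrite normalize-coprime (Coprime.sym (1-coprimeTo k)) = refl

ℕ→ℚ-homo-+ : ∀ a b → ℕ→ℚ (a ℕ.+ b) ≡ ℕ→ℚ a + ℕ→ℚ b
ℕ→ℚ-homo-+ a b = toℚᵘ-injective (begin
  toℚᵘ (ℕ→ℚ (a ℕ.+ b))                   ≡⟨ toℚᵘ-ℕ→ℚ (a ℕ.+ b) ⟩
  mkℚᵘ (ℤ.+ (a ℕ.+ b)) 0                  ≈⟨ *≡* (distrib (ℤ.+ a) (ℤ.+ b)) ⟩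
  mkℚᵘ (ℤ.+ a) 0 ℚᵘ.+ mkℚᵘ (ℤ.+ b) 0      ≡⟨ cong₂ ℚᵘ._+_ (toℚᵘ-ℕ→ℚ a) (toℚᵘ-ℕ→ℚ b) ⟨
  toℚᵘ (ℕ→ℚ a) ℚᵘ.+ toℚᵘ (ℕ→ℚ b)          ≈⟨ toℚᵘ-homo-+ (ℕ→ℚ a) (ℕ→ℚ b) ⟨
  toℚᵘ (ℕ→ℚ a + ℕ→ℚ b)                    ∎)
  where
  open ℚᵘ.≃-Reasoning
  distrib : ∀ x y → (x ℤ.+ y) ℤ.* ℤ.+ 1 ≡ (x ℤ.* ℤ.+ 1 ℤ.+ y ℤ.* ℤ.+ 1) ℤ.* ℤ.+ 1
  distrib = solve-∀

ℕ→ℚ-homo-* : ∀ a b → ℕ→ℚ (a ℕ.* b) ≡ ℕ→ℚ a * ℕ→ℚ b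
ℕ→ℚ-homo-* zero    b = sym (*-zeroˡ (ℕ→ℚ b))
ℕ→ℚ-homo-* (suc a) b = begin
  ℕ→ℚ (b ℕ.+ a ℕ.* b)          ≡⟨ ℕ→ℚ-homo-+ b (a ℕ.* b) ⟩
  ℕ→ℚ b + ℕ→ℚ (a ℕ.* b)        ≡⟨ cong (ℕ→ℚ b +_) (ℕ→ℚ-homo-* a b) ⟩
  ℕ→ℚ b + ℕ→ℚ a * ℕ→ℚ b        ≡⟨ distrib (ℕ→ℚ a) (ℕ→ℚ b) ⟩
  (1ℚ + ℕ→ℚ a) * ℕ→ℚ b         ≡⟨ cong (_* ℕ→ℚ b) (ℕ→ℚ-homo-+ 1 a) ⟨
  ℕ→ℚ (suc a) * ℕ→ℚ b          ∎
  where
  open ≡-Reasoning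
  open +-*-Solver
  distrib : ∀ x y → y + x * y ≡ (1ℚ + x) * y
  distrib = solve 2 (λ x y → y :+ x :* y := (con 1ℚ :+ x) :* y) refl

ℕ→ℚ-nonNeg : ∀ k → 0ℚ ≤ ℕ→ℚ k
ℕ→ℚ-nonNeg k = nonNegative⁻¹ (ℕ→ℚ k) {{normalize-nonNeg k 1}}

ℕ→ℚ-mono-≤ : ∀ {a b} → a ℕ.≤ b → ℕ→ℚ a ≤ ℕ→ℚ b
ℕ→ℚ-mono-≤ {a} a≤b with t , refl ← ℕ.m≤n⇒∃[o]m+o≡n a≤b = begin
  ℕ→ℚ a             ≡⟨ +-identityʳ (ℕ→ℚ a) ⟨
  ℕ→ℚ a + 0ℚ        ≤⟨ +-monoʳ-≤ (ℕ→ℚ a) (ℕ→ℚ-nonNeg t) ⟩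
  ℕ→ℚ a + ℕ→ℚ t     ≡⟨ ℕ→ℚ-homo-+ a t ⟨
  ℕ→ℚ (a ℕ.+ t)     ∎
  where open ≤-Reasoning

ℕ→ℚ-mono-< : ∀ {a b} → a ℕ.< b → ℕ→ℚ a < ℕ→ℚ b
ℕ→ℚ-mono-< {a} a<b with t , refl ← ℕ.m≤n⇒∃[o]m+o≡n a<b = begin-strict
  ℕ→ℚ a                 ≡⟨ +-identityʳ (ℕ→ℚ a) ⟨
  ℕ→ℚ a + 0ℚ            <⟨ +-monoʳ-< (ℕ→ℚ a) (positive⁻¹ (ℕ→ℚ (suc t)) {{normalize-pos (suc t) 1}}) ⟩
  ℕ→ℚ a + ℕ→ℚ (suc t)   ≡⟨ ℕ→ℚ-homo-+ a (suc t) ⟨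
  ℕ→ℚ (a ℕ.+ suc t)     ≡⟨ cong ℕ→ℚ (ℕ.+-suc a t) ⟩
  ℕ→ℚ (suc a ℕ.+ t)     ∎
  where open ≤-Reasoning

ℕ→ℚ-cancel-≤ : ∀ {a b} → ℕ→ℚ a ≤ ℕ→ℚ b → a ℕ.≤ b
ℕ→ℚ-cancel-≤ â≤b̂ = ℕ.≮⇒≥ (λ b<a → <-irrefl refl (<-≤-trans (ℕ→ℚ-mono-< b<a) â≤b̂))

ℕ→ℚ-homo-∸ : ∀ {a b} → b ℕ.≤ a → ℕ→ℚ (a ℕ.∸ b) ≡ ℕ→ℚ a - ℕ→ℚ b
ℕ→ℚ-homo-∸ {a} {b} b≤a = begin
  ℕ→ℚ (a ℕ.∸ b)                          ≡⟨ cancel (ℕ→ℚ (a ℕ.∸ b)) (ℕ→ℚ b) ⟩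
  ℕ→ℚ (a ℕ.∸ b) + ℕ→ℚ b - ℕ→ℚ b          ≡⟨ cong (_- ℕ→ℚ b) (ℕ→ℚ-homo-+ (a ℕ.∸ b) b) ⟨
  ℕ→ℚ (a ℕ.∸ b ℕ.+ b) - ℕ→ℚ b            ≡⟨ cong (λ x → ℕ→ℚ x - ℕ→ℚ b) (ℕ.m∸n+n≡m b≤a) ⟩
  ℕ→ℚ a - ℕ→ℚ b                          ∎
  where
  open ≡-Reasoning
  open +-*-Solver
  cancel : ∀ x y → x ≡ x + y - y
  cancel = solve 2 (λ x y → x := x :+ y :- y) refl

p≤q⇒0≤q-p : ∀ {p q} → p ≤ q → 0ℚ ≤ q - p
p≤q⇒0≤q-p {p} {q} p≤q = subst (_≤ q - p) (+-inverseʳ p) (+-monoˡ-≤ (- p) p≤q)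

p<q⇒0<q-p : ∀ {p q} → p < q → 0ℚ < q - p
p<q⇒0<q-p {p} {q} p<q = subst (_< q - p) (+-inverseʳ p) (+-monoˡ-< (- p) p<q)

p+q<r⇒q<r-p : ∀ {p q r} → p + q < r → q < r - p
p+q<r⇒q<r-p {p} {q} {r} p+q<r = subst (_< r - p) (cancel p q) (+-monoˡ-< (- p) p+q<r)
  where
  open +-*-Solver
  cancel : ∀ p q → p + q - p ≡ q
  cancel = solve 2 (λ p q → p :+ q :- p := q) refl

*-nonNeg : ∀ {p q} → 0ℚ ≤ p → 0ℚ ≤ q → 0ℚ ≤ p * q
*-nonNeg {p} {q} 0≤p 0≤q = nonNegative⁻¹ (p * q) {{nonNeg*nonNeg⇒nonNeg p {{nonNegative 0≤p}} q {{nonNegative 0≤q}}}}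

*-pos : ∀ {p q} → 0ℚ < p → 0ℚ < q → 0ℚ < p * q
*-pos {p} {q} 0<p 0<q = positive⁻¹ (p * q) {{pos*pos⇒pos p {{positive 0<p}} q {{positive 0<q}}}}

≤-suc-* : ∀ {x y β} m → x ≤ β → y ≤ ℕ→ℚ m * β → x + y ≤ ℕ→ℚ (suc m) * β
≤-suc-* {x} {y} {β} m x≤β y≤mβ = begin
  x + y                   ≤⟨ +-mono-≤ x≤β y≤mβ ⟩
  β + ℕ→ℚ m * β           ≡⟨ cong (_+ ℕ→ℚ m * β) (*-identityˡ β) ⟨
  1ℚ * β + ℕ→ℚ m * β      ≡⟨ *-distribʳ-+ β 1ℚ (ℕ→ℚ m) ⟨
  (1ℚ + ℕ→ℚ m) * β        ≡⟨ cong (_* β) (ℕ→ℚ-homo-+ 1 m) ⟨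
  ℕ→ℚ (suc m) * β         ∎
  where open ≤-Reasoning

ℕ→ℚ-∑-bound : ∀ {n w β} (f : Fin n → ℕ) → (∀ v → ℕ→ℚ (f v) * w ≤ β) →
              ℕ→ℚ (∑[ v < n ] f v) * w ≤ ℕ→ℚ n * β
ℕ→ℚ-∑-bound {zero}  {w} {β} f bound = ≤-reflexive (trans (*-zeroˡ w) (sym (*-zeroˡ β)))
ℕ→ℚ-∑-bound {suc n} {w} {β} f bound = begin
  ℕ→ℚ (f Fin.zero ℕ.+ S) * w              ≡⟨ cong (_* w) (ℕ→ℚ-homo-+ (f Fin.zero) S) ⟩
  (ℕ→ℚ (f Fin.zero) + ℕ→ℚ S) * w          ≡⟨ *-distribʳ-+ w (ℕ→ℚ (f Fin.zero)) (ℕ→ℚ S) ⟩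
  ℕ→ℚ (f Fin.zero) * w + ℕ→ℚ S * w        ≤⟨ ≤-suc-* n (bound Fin.zero) (ℕ→ℚ-∑-bound (f ∘ Fin.suc) (bound ∘ Fin.suc)) ⟩
  ℕ→ℚ (suc n) * β                         ∎
  where
  open ≤-Reasoning
  S : ℕ
  S = ∑[ v < n ] f (Fin.suc v)

-- |L| / (n C k) ≤ r / w, kept free of division.
DensityBound : ℕ → ℕ → (ℕ → Set) → ℚ → ℚ → Set
DensityBound n k P w r =
  (L : List (Subset n)) → UniformFamily k P L → ℕ→ℚ (length L) * w ≤ ℕ→ℚ (n C k) * r

-- Each member lies in c slices, so Σ_v |slice s v L| = c |L|, and every slice is a family one level down.
averaging : ∀ {N K c P w r} s → 0 ℕ.< c →
            c ℕ.* (suc N C (𝟙 s ℕ.+ K)) ≡ suc N ℕ.* (N C K) →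
            (∀ (A : Subset (suc N)) → ∣ A ∣ ≡ 𝟙 s ℕ.+ K → sideCount s A ≡ c) →
            DensityBound N K (P ∘ (𝟙 s ℕ.+_)) w r → DensityBound (suc N) (𝟙 s ℕ.+ K) P w r
averaging {N} {K} {c} {P} {w} {r} s 0<c binomial count≡c bound L family =
  *-cancelˡ-≤-pos ĉ {{positive (ℕ→ℚ-mono-< 0<c)}} (begin
    ĉ * (m̂ * w)                                 ≡⟨ *-assoc ĉ m̂ w ⟨
    ĉ * m̂ * w                                   ≡⟨ cong (_* w) (trans (ℕ→ℚ-homo-* m c) (*-comm m̂ ĉ)) ⟨
    ℕ→ℚ (m ℕ.* c) * w                           ≡⟨ cong (λ x → ℕ→ℚ x * w) (∑-length-slice s L counts) ⟨
    ℕ→ℚ (∑[ v < suc N ] length (slice s v L)) * w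
      ≤⟨ ℕ→ℚ-∑-bound (λ v → length (slice s v L)) (λ v → bound (slice s v L) (slice-uniform {P = P} s v family)) ⟩
    ℕ→ℚ (suc N) * (ℕ→ℚ (N C K) * r)             ≡⟨ *-assoc (ℕ→ℚ (suc N)) _ r ⟨
    ℕ→ℚ (suc N) * ℕ→ℚ (N C K) * r               ≡⟨ cong (_* r) (ℕ→ℚ-homo-* (suc N) (N C K)) ⟨
    ℕ→ℚ (suc N ℕ.* (N C K)) * r                 ≡⟨ cong (λ x → ℕ→ℚ x * r) binomial ⟨
    ℕ→ℚ (c ℕ.* (suc N C (𝟙 s ℕ.+ K))) * r       ≡⟨ cong (_* r) (ℕ→ℚ-homo-* c _) ⟩
    ĉ * ℕ→ℚ (suc N C (𝟙 s ℕ.+ K)) * r           ≡⟨ *-assoc ĉ _ r ⟩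
    ĉ * (ℕ→ℚ (suc N C (𝟙 s ℕ.+ K)) * r)         ∎)
  where
  open ≤-Reasoning
  m : ℕ
  m = length L
  m̂ ĉ : ℚ
  m̂ = ℕ→ℚ m
  ĉ = ℕ→ℚ c
  counts : All (λ A → sideCount s A ≡ c) L
  counts = All.map (λ {A} → count≡c A) (proj₁ family)

density-in : ∀ {N K P w r} → DensityBound N K (P ∘ suc) w r → DensityBound (suc N) (suc K) P w r
density-in {N} {K} {P} = averaging {P = P} inside (s≤s z≤n) (suc-*-C-suc N K) (λ _ → id)

density-out : ∀ {N K P w r} → K ℕ.≤ N → DensityBound N K P w r → DensityBound (suc N) K P w r
density-out {N} {K} {P} K≤N = averaging {P = P} outside (ℕ.m<n⇒0<n∸m (s≤s K≤N)) (∸-*-C K≤N) count-outside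
  where
  count-outside : ∀ (A : Subset (suc N)) → ∣ A ∣ ≡ K → sideCount outside A ≡ suc N ℕ.∸ K
  count-outside A refl = sym (trans (cong (ℕ._∸ ∣ A ∣) (sym (sideCount-outside+∣∣ A))) (ℕ.m+n∸n≡m _ ∣ A ∣))

density-lift-in : ∀ {n k P w r} a → DensityBound n k (P ∘ (a ℕ.+_)) w r → DensityBound (a ℕ.+ n) (a ℕ.+ k) P w r
density-lift-in         zero    = id
density-lift-in {P = P} (suc a) = density-in {P = P} ∘ density-lift-in {P = P ∘ suc} a

density-lift-out : ∀ {n k P w r} b → k ℕ.≤ n → DensityBound n k P w r → DensityBound (b ℕ.+ n) k P w r
density-lift-out         zero    k≤n = id
density-lift-out {P = P} (suc b) k≤n = density-out {P = P} (ℕ.≤-trans k≤n (ℕ.m≤n+m _ b)) ∘ density-lift-out {P = P} b k≤n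

density-weaken : ∀ {n k P Q w r} → (∀ {t} → Q t → P t) → DensityBound n k P w r → DensityBound n k Q w r
density-weaken Q⇒P bound L (sizes , pairs) = bound L (sizes , AllPairs.map Q⇒P pairs)

intersections-bound : ∀ {n} θ (A : Subset n) {L} → All (λ B → ℕ→ℚ ∣ A ∩ B ∣ ≤ θ) L →
                      ℕ→ℚ (intersections A L) ≤ ℕ→ℚ (length L) * θ
intersections-bound θ A []                       = ≤-reflexive (sym (*-zeroˡ θ))
intersections-bound θ A {B ∷ L} (A∩B≤θ ∷ bounds) = begin
  ℕ→ℚ (∣ A ∩ B ∣ ℕ.+ intersections A L)        ≡⟨ ℕ→ℚ-homo-+ ∣ A ∩ B ∣ (intersections A L) ⟩
  ℕ→ℚ ∣ A ∩ B ∣ + ℕ→ℚ (intersections A L)      ≤⟨ ≤-suc-* (length L) A∩B≤θ (intersections-bound θ A bounds) ⟩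
  ℕ→ℚ (length (B ∷ L)) * θ                     ∎
  where open ≤-Reasoning

moment₂-bound : ∀ {n k} θ (L : List (Subset n)) → UniformFamily k (λ t → ℕ→ℚ t ≤ θ) L →
                ℕ→ℚ (moment₂ L) ≤ ℕ→ℚ (length L) * ℕ→ℚ k + ℕ→ℚ (length L) * (ℕ→ℚ (length L) - 1ℚ) * θ
moment₂-bound {n} {k} θ [] _ = ≤-reflexive (trans (cong ℕ→ℚ (sum-replicate-zero n)) (vanish (ℕ→ℚ k) θ))
  where
  open +-*-Solver
  vanish : ∀ k θ → 0ℚ ≡ 0ℚ * k + 0ℚ * (0ℚ - 1ℚ) * θ
  vanish = solve 2 (λ k θ → con 0ℚ := con 0ℚ :* k :+ con 0ℚ :* (con 0ℚ :- con 1ℚ) :* θ) refl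
moment₂-bound θ (A ∷ L) (refl ∷ sizes , meets ∷ pairs) = begin
  ℕ→ℚ (moment₂ (A ∷ L))
    ≡⟨ cong ℕ→ℚ (moment₂-∷ A L) ⟩
  ℕ→ℚ (∣ A ∣ ℕ.+ 2 ℕ.* intersections A L ℕ.+ moment₂ L)
    ≡⟨ trans (ℕ→ℚ-homo-+ (∣ A ∣ ℕ.+ 2 ℕ.* intersections A L) (moment₂ L))
             (cong (_+ ℕ→ℚ (moment₂ L)) (trans (ℕ→ℚ-homo-+ ∣ A ∣ (2 ℕ.* intersections A L))
                                               (cong (k̂ +_) (ℕ→ℚ-homo-* 2 (intersections A L))))) ⟩
  k̂ + 2̂ * ℕ→ℚ (intersections A L) + ℕ→ℚ (moment₂ L)
    ≤⟨ +-mono-≤ (+-monoʳ-≤ k̂ (*-monoˡ-≤-nonNeg 2̂ {{nonNegative (ℕ→ℚ-nonNeg 2)}} (intersections-bound θ A meets)))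
                (moment₂-bound θ L (sizes , pairs)) ⟩
  k̂ + 2̂ * (m̂ * θ) + (m̂ * k̂ + m̂ * (m̂ - 1ℚ) * θ)
    ≡⟨ regroup k̂ m̂ θ 2̂ 2̂≡1+1 ⟩
  (1ℚ + m̂) * k̂ + (1ℚ + m̂) * (1ℚ + m̂ - 1ℚ) * θ
    ≡⟨ cong (λ x → x * k̂ + x * (x - 1ℚ) * θ) (ℕ→ℚ-homo-+ 1 (length L)) ⟨
  ℕ→ℚ (length (A ∷ L)) * k̂ + ℕ→ℚ (length (A ∷ L)) * (ℕ→ℚ (length (A ∷ L)) - 1ℚ) * θ
    ∎
  where
  open ≤-Reasoning
  open +-*-Solver
  k̂ m̂ 2̂ : ℚ
  k̂ = ℕ→ℚ ∣ A ∣
  m̂ = ℕ→ℚ (length L)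
  2̂ = ℕ→ℚ 2
  2̂≡1+1 : 2̂ ≡ 1ℚ + 1ℚ
  2̂≡1+1 = refl
  regroup : ∀ k m θ two → two ≡ 1ℚ + 1ℚ →
            k + two * (m * θ) + (m * k + m * (m - 1ℚ) * θ) ≡ (1ℚ + m) * k + (1ℚ + m) * (1ℚ + m - 1ℚ) * θ
  regroup k m θ two refl = expand k m θ
    where
    expand : ∀ k m θ → k + (1ℚ + 1ℚ) * (m * θ) + (m * k + m * (m - 1ℚ) * θ) ≡ (1ℚ + m) * k + (1ℚ + m) * (1ℚ + m - 1ℚ) * θ
    expand = solve 3 (λ k m θ → k :+ (con 1ℚ :+ con 1ℚ) :* (m :* θ) :+ (m :* k :+ m :* (m :- con 1ℚ) :* θ)
                              := (con 1ℚ :+ m) :* k :+ (con 1ℚ :+ m) :* (con 1ℚ :+ m :- con 1ℚ) :* θ) refl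

johnson-bound : ∀ {n k} θ → θ ≤ ℕ→ℚ k → (L : List (Subset n)) → UniformFamily k (λ t → ℕ→ℚ t ≤ θ) L →
                ℕ→ℚ (length L) * (ℕ→ℚ k * ℕ→ℚ k - ℕ→ℚ n * θ) ≤ ℕ→ℚ n * (ℕ→ℚ k - θ)
johnson-bound {n} {k} θ θ≤k [] _ = begin
  0ℚ * (k̂ * k̂ - n̂ * θ)    ≡⟨ *-zeroˡ (k̂ * k̂ - n̂ * θ) ⟩
  0ℚ                      ≤⟨ *-nonNeg (ℕ→ℚ-nonNeg n) (p≤q⇒0≤q-p θ≤k) ⟩
  n̂ * (k̂ - θ)             ∎
  where
  open ≤-Reasoning
  k̂ n̂ : ℚ
  k̂ = ℕ→ℚ k
  n̂ = ℕ→ℚ n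
johnson-bound {n} {k} θ θ≤k L@(_ ∷ _) family@(sizes , _) =
  *-cancelˡ-≤-pos m̂ {{positive (ℕ→ℚ-mono-< {0} {length L} (s≤s z≤n))}} (begin
    m̂ * (m̂ * (k̂ * k̂ - n̂ * θ))                          ≡⟨ expand m̂ k̂ n̂ θ ⟩
    m̂ * k̂ * (m̂ * k̂) - n̂ * (m̂ * m̂ * θ)                  ≤⟨ +-monoˡ-≤ (- (n̂ * (m̂ * m̂ * θ))) second-moment ⟩
    n̂ * (m̂ * k̂ + m̂ * (m̂ - 1ℚ) * θ) - n̂ * (m̂ * m̂ * θ)  ≡⟨ collect m̂ k̂ n̂ θ ⟩
    m̂ * (n̂ * (k̂ - θ))                                   ∎)
  where
  open ≤-Reasoning
  open +-*-Solver
  m̂ k̂ n̂ : ℚ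
  m̂ = ℕ→ℚ (length L)
  k̂ = ℕ→ℚ k
  n̂ = ℕ→ℚ n
  second-moment : m̂ * k̂ * (m̂ * k̂) ≤ n̂ * (m̂ * k̂ + m̂ * (m̂ - 1ℚ) * θ)
  second-moment = begin
    m̂ * k̂ * (m̂ * k̂)                      ≡⟨ cong₂ _*_ (ℕ→ℚ-homo-* (length L) k) (ℕ→ℚ-homo-* (length L) k) ⟨
    ℕ→ℚ (length L ℕ.* k) * ℕ→ℚ (length L ℕ.* k)
                                          ≡⟨ ℕ→ℚ-homo-* (length L ℕ.* k) (length L ℕ.* k) ⟨
    ℕ→ℚ (length L ℕ.* k ℕ.* (length L ℕ.* k))
                                          ≤⟨ ℕ→ℚ-mono-≤ (square-≤-moment₂ L sizes) ⟩
    ℕ→ℚ (n ℕ.* moment₂ L)                 ≡⟨ ℕ→ℚ-homo-* n (moment₂ L) ⟩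
    n̂ * ℕ→ℚ (moment₂ L)                   ≤⟨ *-monoˡ-≤-nonNeg n̂ {{nonNegative (ℕ→ℚ-nonNeg n)}} (moment₂-bound θ L family) ⟩
    n̂ * (m̂ * k̂ + m̂ * (m̂ - 1ℚ) * θ)       ∎
  expand : ∀ m k n θ → m * (m * (k * k - n * θ)) ≡ m * k * (m * k) - n * (m * m * θ)
  expand = solve 4 (λ m k n θ → m :* (m :* (k :* k :- n :* θ)) := m :* k :* (m :* k) :- n :* (m :* m :* θ)) refl
  collect : ∀ m k n θ → n * (m * k + m * (m - 1ℚ) * θ) - n * (m * m * θ) ≡ m * (n * (k - θ))
  collect = solve 4 (λ m k n θ → n :* (m :* k :+ m :* (m :- con 1ℚ) :* θ) :- n :* (m :* m :* θ) := m :* (n :* (k :- θ))) refl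

johnson-density : ∀ {n k} θ → θ ≤ ℕ→ℚ k →
                  DensityBound n k (λ t → ℕ→ℚ t ≤ θ) ((ℕ→ℚ k * ℕ→ℚ k - ℕ→ℚ n * θ) * ℕ→ℚ (n C k)) (ℕ→ℚ n * (ℕ→ℚ k - θ))
johnson-density {n} {k} θ θ≤k L family = begin
  m̂ * (Δ * Ĉ)    ≡⟨ *-assoc m̂ Δ Ĉ ⟨
  m̂ * Δ * Ĉ      ≤⟨ *-monoʳ-≤-nonNeg Ĉ {{nonNegative (ℕ→ℚ-nonNeg (n C k))}} (johnson-bound θ θ≤k L family) ⟩
  Γ * Ĉ          ≡⟨ *-comm Γ Ĉ ⟩
  Ĉ * Γ          ∎
  where
  open ≤-Reasoning
  m̂ Ĉ Δ Γ : ℚ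
  m̂ = ℕ→ℚ (length L)
  Ĉ = ℕ→ℚ (n C k)
  Δ = ℕ→ℚ k * ℕ→ℚ k - ℕ→ℚ n * θ
  Γ = ℕ→ℚ n * (ℕ→ℚ k - θ)

restricted-johnson-density :
  ∀ {n D K E} λ₀ → D ℕ.≤ K → K ℕ.≤ E → E ℕ.≤ n → λ₀ ≤ ℕ→ℚ K →
  let k̂ = ℕ→ℚ (K ℕ.∸ D); n̂ = ℕ→ℚ (E ℕ.∸ D); θ = λ₀ - ℕ→ℚ D in
  DensityBound n K (λ t → ℕ→ℚ t < λ₀) ((k̂ * k̂ - n̂ * θ) * ℕ→ℚ ((E ℕ.∸ D) C (E ℕ.∸ K))) (n̂ * (k̂ - θ))
restricted-johnson-density {n} {D} {K} {E} λ₀ D≤K K≤E E≤n λ₀≤K =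
  subst (λ b → DensityBound n K P (Δ * ℕ→ℚ b) Γ) binomial-symmetry
    (subst₂ (λ N M → DensityBound N M P (Δ * ℕ→ℚ (n′ C k′)) Γ) n≡ K≡
      (density-lift-out {P = P} (n ℕ.∸ E) (ℕ.+-monoʳ-≤ D k′≤n′)
        (density-lift-in {P = P} D
          (density-weaken {P = λ t → ℕ→ℚ t ≤ θ} {Q = P ∘ (D ℕ.+_)} shift (johnson-density θ θ≤k′)))))
  where
  P : ℕ → Set
  P t = ℕ→ℚ t < λ₀
  k′ n′ : ℕ
  k′ = K ℕ.∸ D
  n′ = E ℕ.∸ D
  θ Δ Γ : ℚ
  θ = λ₀ - ℕ→ℚ D
  Δ = ℕ→ℚ k′ * ℕ→ℚ k′ - ℕ→ℚ n′ * θ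
  Γ = ℕ→ℚ n′ * (ℕ→ℚ k′ - θ)
  k′≤n′ : k′ ℕ.≤ n′
  k′≤n′ = ℕ.∸-monoˡ-≤ D K≤E
  θ≤k′ : θ ≤ ℕ→ℚ k′
  θ≤k′ = subst (θ ≤_) (sym (ℕ→ℚ-homo-∸ D≤K)) (+-monoˡ-≤ (- ℕ→ℚ D) λ₀≤K)
  shift : ∀ {t} → P (D ℕ.+ t) → ℕ→ℚ t ≤ θ
  shift {t} D+t<λ₀ = <⇒≤ (p+q<r⇒q<r-p (subst (_< λ₀) (ℕ→ℚ-homo-+ D t) D+t<λ₀))
  K≡ : D ℕ.+ k′ ≡ K
  K≡ = ℕ.m+[n∸m]≡n D≤K
  n≡ : n ℕ.∸ E ℕ.+ (D ℕ.+ n′) ≡ n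
  n≡ = trans (cong (n ℕ.∸ E ℕ.+_) (ℕ.m+[n∸m]≡n (ℕ.≤-trans D≤K K≤E))) (ℕ.m∸n+n≡m E≤n)
  binomial-symmetry : n′ C k′ ≡ n′ C (E ℕ.∸ K)
  binomial-symmetry = trans (nCk≡nC[n∸k] k′≤n′)
    (cong (n′ C_) (trans (ℕ.∸-+-assoc E D k′) (cong (E ℕ.∸_) K≡)))

/'-*-cancel : ∀ p {q} → 0ℚ < q → (p /' q) * q ≡ p
/'-*-cancel p {q} 0<q with q ≟ 0ℚ
... | yes q≡0 = ⊥-elim (<-irrefl (sym q≡0) 0<q)
... | no  q≢0 = trans (*-assoc p _ q) (trans (cong (p *_) (*-inverseˡ q {{≢-nonZero q≢0}})) (*-identityʳ p))

≤-/' : ∀ {p q r} → 0ℚ < r → p * r ≤ q → p ≤ q /' r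
≤-/' {p} {q} {r} 0<r pr≤q = *-cancelʳ-≤-pos r {{positive 0<r}} (≤-trans pr≤q (≤-reflexive (sym (/'-*-cancel q 0<r))))

gap-scaled : ∀ {a b g N k n θ} → 0ℚ < a → 0ℚ < b → a * N ≡ k → b * N ≡ n → g * N ≡ θ →
             (a /' b - g /' a) * (a * b * N * N) ≡ k * k - n * θ
gap-scaled {a} {b} {g} {N} {k} {n} {θ} 0<a 0<b aN≡k bN≡n θ-scaled = begin
  (a /' b - g /' a) * (a * b * N * N)                      ≡⟨ split (a /' b) (g /' a) a b N ⟩
  (a /' b) * b * (a * N * N) - (g /' a) * a * (b * N * N)  ≡⟨ cong₂ (λ u v → u * (a * N * N) - v * (b * N * N))
                                                                    (/'-*-cancel a 0<b) (/'-*-cancel g 0<a) ⟩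
  a * (a * N * N) - g * (b * N * N)                        ≡⟨ regroup a b g N ⟩
  (a * N) * (a * N) - (b * N) * (g * N)                    ≡⟨ cong₂ (λ u v → u * u - v) aN≡k (cong₂ _*_ bN≡n θ-scaled) ⟩
  k * k - n * θ                                            ∎
  where
  open ≡-Reasoning
  open +-*-Solver
  split : ∀ x y a b N → (x - y) * (a * b * N * N) ≡ x * b * (a * N * N) - y * a * (b * N * N)
  split = solve 5 (λ x y a b N → (x :- y) :* (a :* b :* N :* N) := x :* b :* (a :* N :* N) :- y :* a :* (b :* N :* N)) refl
  regroup : ∀ a b g N → a * (a * N * N) - g * (b * N * N) ≡ (a * N) * (a * N) - (b * N) * (g * N)
  regroup = solve 4 (λ a b g N → a :* (a :* N :* N) :- g :* (b :* N :* N) := (a :* N) :* (a :* N) :- (b :* N) :* (g :* N)) refl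

slack-scaled : ∀ {a b g N k n θ} → 0ℚ < a → a * N ≡ k → b * N ≡ n → g * N ≡ θ →
               (1ℚ - g /' a) * (a * b * N * N) ≡ n * (k - θ)
slack-scaled {a} {b} {g} {N} {k} {n} {θ} 0<a aN≡k bN≡n θ-scaled = begin
  (1ℚ - g /' a) * (a * b * N * N)             ≡⟨ split (g /' a) a b N ⟩
  a * b * N * N - (g /' a) * a * (b * N * N)  ≡⟨ cong (λ v → a * b * N * N - v * (b * N * N)) (/'-*-cancel g 0<a) ⟩
  a * b * N * N - g * (b * N * N)             ≡⟨ regroup a b g N ⟩
  (b * N) * (a * N - g * N)                   ≡⟨ cong₂ (λ u v → u * v) bN≡n (cong₂ _-_ aN≡k θ-scaled) ⟩
  n * (k - θ)                                 ∎
  where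
  open ≡-Reasoning
  open +-*-Solver
  split : ∀ y a b N → (1ℚ - y) * (a * b * N * N) ≡ a * b * N * N - y * a * (b * N * N)
  split = solve 4 (λ y a b N → (con 1ℚ :- y) :* (a :* b :* N :* N) := a :* b :* N :* N :- y :* a :* (b :* N :* N)) refl
  regroup : ∀ a b g N → a * b * N * N - g * (b * N * N) ≡ (b * N) * (a * N - g * N)
  regroup = solve 4 (λ a b g N → a :* b :* N :* N :- g :* (b :* N :* N) := (b :* N) :* (a :* N :- g :* N)) refl

Nfun-bound : ∀ a b g {N k n θ Ĉ Ĉ′ m} → 0ℚ < a → 0ℚ < b → 0ℚ < N →
             a * N ≡ k → b * N ≡ n → g * N ≡ θ → g /' a < a /' b → 0ℚ < Ĉ′ →
             m * ((k * k - n * θ) * Ĉ′) ≤ Ĉ * (n * (k - θ)) →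
             m ≤ (Ĉ * Nfun (a /' b) (g /' a)) /' Ĉ′
Nfun-bound a b g {N} {k} {n} {θ} {Ĉ} {Ĉ′} {m} 0<a 0<b 0<N aN≡k bN≡n θ-scaled y<x 0<Ĉ′ bound =
  ≤-/' 0<Ĉ′ (*-cancelʳ-≤-pos (s * W) {{positive (*-pos 0<s 0<W)}} (begin
    m * Ĉ′ * (s * W)                     ≡⟨ cong (λ z → m * Ĉ′ * z) (gap-scaled 0<a 0<b aN≡k bN≡n θ-scaled) ⟩
    m * Ĉ′ * (k * k - n * θ)             ≡⟨ swap m Ĉ′ (k * k - n * θ) ⟩
    m * ((k * k - n * θ) * Ĉ′)           ≤⟨ bound ⟩
    Ĉ * (n * (k - θ))                    ≡⟨ cong (Ĉ *_) (slack-scaled 0<a aN≡k bN≡n θ-scaled) ⟨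
    Ĉ * ((1ℚ - y) * W)                   ≡⟨ cong (λ z → Ĉ * (z * W)) (/'-*-cancel (1ℚ - y) 0<s) ⟨
    Ĉ * ((Nfun x y * s) * W)             ≡⟨ reassoc Ĉ (Nfun x y) s W ⟩
    Ĉ * Nfun x y * (s * W)               ∎))
  where
  open ≤-Reasoning
  open +-*-Solver
  x y s W : ℚ
  x = a /' b
  y = g /' a
  s = x - y
  W = a * b * N * N
  0<s : 0ℚ < s
  0<s = p<q⇒0<q-p y<x
  0<W : 0ℚ < W
  0<W = *-pos (*-pos (*-pos 0<a 0<b) 0<N) 0<N
  swap : ∀ m c d → m * c * d ≡ m * (d * c)
  swap = solve 3 (λ m c d → m :* c :* d := m :* (d :* c)) refl
  reassoc : ∀ c f g w → c * ((f * g) * w) ≡ c * f * (g * w)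
  reassoc = solve 4 (λ c f g w → c :* ((f :* g) :* w) := c :* f :* (g :* w)) refl

scale-≤ : ∀ {u v} n {a b} → u ≤ v → u * ℕ→ℚ n ≡ ℕ→ℚ a → v * ℕ→ℚ n ≡ ℕ→ℚ b → a ℕ.≤ b
scale-≤ {u} {v} n u≤v un≡a vn≡b =
  ℕ→ℚ-cancel-≤ (subst₂ _≤_ un≡a vn≡b (*-monoʳ-≤-nonNeg (ℕ→ℚ n) {{nonNegative (ℕ→ℚ-nonNeg n)}} u≤v))

scale-∸ : ∀ u v n {a b} → b ℕ.≤ a → u * ℕ→ℚ n ≡ ℕ→ℚ a → v * ℕ→ℚ n ≡ ℕ→ℚ b → (u - v) * ℕ→ℚ n ≡ ℕ→ℚ (a ℕ.∸ b)
scale-∸ u v n {a} {b} b≤a un≡a vn≡b = begin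
  (u - v) * ℕ→ℚ n              ≡⟨ distrib u v (ℕ→ℚ n) ⟩
  u * ℕ→ℚ n - v * ℕ→ℚ n        ≡⟨ cong₂ _-_ un≡a vn≡b ⟩
  ℕ→ℚ a - ℕ→ℚ b                ≡⟨ ℕ→ℚ-homo-∸ b≤a ⟨
  ℕ→ℚ (a ℕ.∸ b)                ∎
  where
  open ≡-Reasoning
  open +-*-Solver
  distrib : ∀ u v n → (u - v) * n ≡ u * n - v * n
  distrib = solve 3 (λ u v n → (u :- v) :* n := u :* n :- v :* n) refl

corollary3p2 :
    (c α e d : ℚ) →
    0ℚ ≤ c → c ≤ 1ℚ → 0ℚ ≤ α → α ≤ 1ℚ →
    c ≤ e → e ≤ 1ℚ →
    0ℚ ≤ d → d ≤ α * c → d < c →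
    ((α * c - d) /' (c - d)) < ((c - d) /' (e - d)) →
    (n : ℕ) → 0 ℕ.< n →
    (Kc Kd Ke : ℕ) →
    c * ℕ→ℚ n ≡ ℕ→ℚ Kc → d * ℕ→ℚ n ≡ ℕ→ℚ Kd → e * ℕ→ℚ n ≡ ℕ→ℚ Ke →
    (m : ℕ) (F : Fin m → Subset n) → Admissible n Kc α m F →
    ℕ→ℚ m ≤
      (ℕ→ℚ (n C Kc) * Nfun ((c - d) /' (e - d)) ((α * c - d) /' (c - d)))
        /' ℕ→ℚ ((Ke ℕ.∸ Kd) C (Ke ℕ.∸ Kc))
corollary3p2 c α e d _ _ _ α≤1 c≤e e≤1 _ _ d<c y<x n 0<n Kc Kd Ke cn≡Kc dn≡Kd en≡Ke m F (sizes , pairs) =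
  Nfun-bound (c - d) (e - d) (α * c - d) {Ĉ = ℕ→ℚ (n C Kc)}
    (p<q⇒0<q-p d<c) (p<q⇒0<q-p (<-≤-trans d<c c≤e)) (ℕ→ℚ-mono-< 0<n)
    (scale-∸ c d n Kd≤Kc cn≡Kc dn≡Kd) (scale-∸ e d n (ℕ.≤-trans Kd≤Kc Kc≤Ke) en≡Ke dn≡Kd) θ-scaled
    y<x (ℕ→ℚ-mono-< (C-pos (ℕ.∸-monoʳ-≤ Ke Kd≤Kc)))
    (subst (λ l → ℕ→ℚ l * _ ≤ _) (length-tabulate F)
      (restricted-johnson-density (α * ℕ→ℚ Kc) Kd≤Kc Kc≤Ke Ke≤n αKc≤Kc (tabulate F) family))
  where
  Kd≤Kc : Kd ℕ.≤ Kc
  Kd≤Kc = scale-≤ n (<⇒≤ d<c) dn≡Kd cn≡Kc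
  Kc≤Ke : Kc ℕ.≤ Ke
  Kc≤Ke = scale-≤ n c≤e cn≡Kc en≡Ke
  Ke≤n : Ke ℕ.≤ n
  Ke≤n = scale-≤ n e≤1 en≡Ke (*-identityˡ (ℕ→ℚ n))
  θ-scaled : (α * c - d) * ℕ→ℚ n ≡ α * ℕ→ℚ Kc - ℕ→ℚ Kd
  θ-scaled = trans (distrib α c d (ℕ→ℚ n)) (cong₂ (λ u v → α * u - v) cn≡Kc dn≡Kd)
    where
    open +-*-Solver
    distrib : ∀ α c d N → (α * c - d) * N ≡ α * (c * N) - d * N
    distrib = solve 4 (λ α c d N → (α :* c :- d) :* N := α :* (c :* N) :- d :* N) refl
  αKc≤Kc : α * ℕ→ℚ Kc ≤ ℕ→ℚ Kc
  αKc≤Kc = subst (α * ℕ→ℚ Kc ≤_) (*-identityˡ (ℕ→ℚ Kc)) (*-monoʳ-≤-nonNeg (ℕ→ℚ Kc) {{nonNegative (ℕ→ℚ-nonNeg Kc)}} α≤1)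
  family : UniformFamily Kc (λ t → ℕ→ℚ t < α * ℕ→ℚ Kc) (tabulate F)
  family = tabulate⁺ sizes , AllPairs.tabulate⁺ {R = λ A B → ℕ→ℚ ∣ A ∩ B ∣ < α * ℕ→ℚ Kc} (λ {i} {j} i≢j → proj₂ (pairs i j i≢j))
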